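{- Let $H$ be any graph. Then there exist infinitely many graphs $G$ whose $\operatorname{ir}$-graph is isomorphic to $H$, infinitely many graphs $G$ whose $\gamma_{pr}$-graph is isomorphic to $H$, infinitely many graphs $G$ whose $\gamma_t$-graph is isomorphic to $H$, and infinitely many graphs $G$ whose $\gamma_c$-graph is isomorphic to $H$.
   Context: All graphs are finite and simple. For a graph $G$ and $S\subseteq V(G)$, the private neighbourhood of $v\in S$ is $pn[v,S]=N[v]-N[S-\{v\}]$. $S$ is irredundant if $pn[v,S]\neq\varnothing$ for every $v\in S$, and maximal irredundant if no proper superset is irredundant; $\operatorname{ir}(G)$ is the minimum size of a maximal irredundant set. $S$ is dominating if every vertex is in $S$ or adjacent to a vertex of $S$; total dominating if every vertex of $G$ (including those in $S$) has a neighbour in $S$; paired dominating if it is total dominating and $G[S]$ has a perfect matching; connected dominating if it is dominating and $G[S]$ is connected. $\gamma_t(G),\gamma_{pr}(G),\gamma_c(G)$ are the minimum cardinalities of such sets. For a parameter $\pi\in\{\operatorname{ir},\gamma_{pr},\gamma_t,\gamma_c\}$, the $\pi$-graph of $G$ is the graph whose vertices correspond to the minimum-cardinality sets of the respective type (minimum maximal irredundant, total dominating, paired dominating, connected dominating sets), in which the vertices corresponding to sets $S_u,S_w$ are adjacent iff there exist $u'\in S_u$, $w'\in S_w$ with $u'w'\in E(G)$ and $S_w=(S_u-\{u'\})\cup\{w'\}$ (slide adjacency). -}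

module Defs where

open import Data.Nat using (ℕ; _≤_)
open import Data.Bool using (Bool; true; false; T)
open import Data.Fin using (Fin)
open import Data.Fin.Subset using (Subset; _∈_; _∉_; _⊂_; _∪_; _-_; ⁅_⁆; ∣_∣)
open import Data.Product using (Σ; ∃; ∃-syntax; _×_; _,_)
open import Data.Sum using (_⊎_)
open import Relation.Nullary using (¬_)
open import Relation.Binary.PropositionalEquality using (_≡_; _≢_)

record Graph : Set where
  field
    n     : ℕ
    adj   : Fin n → Fin n → Bool
    sym   : ∀ u v → adj u v ≡ adj v u
    irref : ∀ v → adj v v ≡ false

open Graph public

Edge : (G : Graph) → Fin (n G) → Fin (n G) → Set
Edge G u v = T (adj G u v)

VSet : Graph → Set
VSet G = Subset (n G)

InClosedNbhd : (G : Graph) → Fin (n G) → Fin (n G) → Set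
InClosedNbhd G x v = x ≡ v ⊎ Edge G x v

IsPrivate : (G : Graph) → VSet G → Fin (n G) → Fin (n G) → Set
IsPrivate G S v x =
  InClosedNbhd G x v × (∀ w → w ∈ S → w ≢ v → ¬ InClosedNbhd G x w)

Irredundant : (G : Graph) → VSet G → Set
Irredundant G S = ∀ v → v ∈ S → ∃[ x ] IsPrivate G S v x

MaxIrredundant : (G : Graph) → VSet G → Set
MaxIrredundant G S = Irredundant G S × (∀ T → S ⊂ T → ¬ Irredundant G T)

Dominating : (G : Graph) → VSet G → Set
Dominating G S = ∀ x → x ∈ S ⊎ (∃[ w ] (w ∈ S × Edge G x w))

TotalDominating : (G : Graph) → VSet G → Set
TotalDominating G S = ∀ x → ∃[ w ] (w ∈ S × Edge G x w)

-- G[S] has a perfect matching, given as a partner function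
-- (an involution on S pairing each vertex with an adjacent vertex of S)
HasPerfectMatching : (G : Graph) → VSet G → Set
HasPerfectMatching G S =
  Σ (Fin (n G) → Fin (n G)) λ m →
    ∀ v → v ∈ S → (m v ∈ S × Edge G v (m v) × m (m v) ≡ v)

PairedDominating : (G : Graph) → VSet G → Set
PairedDominating G S = TotalDominating G S × HasPerfectMatching G S

data WalkIn (G : Graph) (S : VSet G) : Fin (n G) → Fin (n G) → Set where
  here  : ∀ {u} → u ∈ S → WalkIn G S u u
  there : ∀ {u w v} → u ∈ S → Edge G u w → WalkIn G S w v → WalkIn G S u v

InducedConnected : (G : Graph) → VSet G → Set
InducedConnected G S = ∀ u v → u ∈ S → v ∈ S → WalkIn G S u v

ConnectedDominating : (G : Graph) → VSet G → Set
ConnectedDominating G S = Dominating G S × InducedConnected G S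

IsMinimum : (G : Graph) → (VSet G → Set) → VSet G → Set
IsMinimum G P S = P S × (∀ T → P T → ∣ S ∣ ≤ ∣ T ∣)

data Param : Set where
  ir γpr γt γc : Param

SetType : Param → (G : Graph) → VSet G → Set
SetType ir  G = MaxIrredundant G
SetType γpr G = PairedDominating G
SetType γt  G = TotalDominating G
SetType γc  G = ConnectedDominating G

IsPiSet : Param → (G : Graph) → VSet G → Set
IsPiSet π G = IsMinimum G (SetType π G)

SlideAdj : (G : Graph) → VSet G → VSet G → Set
SlideAdj G S T =
  ∃[ u ] ∃[ w ] (u ∈ S × w ∈ T × Edge G u w × T ≡ (S - u) ∪ ⁅ w ⁆)

PiGraphIso : Param → (G H : Graph) → Set
PiGraphIso π G H =
  Σ (Fin (n H) → VSet G) λ f →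
    (∀ a → IsPiSet π G (f a)) ×
    (∀ a b → f a ≡ f b → a ≡ b) ×
    (∀ S → IsPiSet π G S → ∃[ a ] f a ≡ S) ×
    (∀ a b → (Edge H a b → SlideAdj G (f a) (f b)) × (SlideAdj G (f a) (f b) → Edge H a b))

-- "infinitely many graphs G whose π-graph is isomorphic to H":
-- graphs of arbitrarily large order (equivalently, infinitely many
-- pairwise non-isomorphic such G, as there are finitely many graphs of each order)
InfinitelyManyRealise : Param → Graph → Set
InfinitelyManyRealise π H = ∀ k → ∃[ G ] (k ≤ n G × PiGraphIso π G H)

module Submission where

-- Given H and m, let G consist of a copy e(V(H)) of H, a centre c adjacent to
-- e(V(H)) and to m + 3 pendant leaves, and two apexes z₀, z₁ adjacent to
-- exactly e(V(H)).  For each of the four set types the minimum sets of G are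
-- exactly the pairs {c, e a}, and {c, e a}, {c, e b} are slide-adjacent iff
-- ab ∈ E(H); so the π-graph of G is H, and G has at least m vertices.

open import Defs hiding (sym)
open import Data.Nat using (ℕ; _≤_; _+_; z≤n; s≤s)
open import Data.Nat.Properties using (≤-trans; ≤-reflexive; ≤-total; n≤1+n; +-suc; m≤n+m)
open import Data.Bool using (Bool; true; false; T)
open import Data.Unit using (tt)
open import Data.Empty using (⊥; ⊥-elim)
open import Data.Vec using (_∷_; []; here; there)
open import Data.Fin using (Fin; zero; suc; fromℕ<; splitAt; _↑ˡ_; _↑ʳ_)
open import Data.Fin.Properties
  using (_≟_; 0≢1+n; suc-injective; ↑ˡ-injective; ↑ʳ-injective;
         splitAt-↑ˡ; splitAt-↑ʳ; splitAt⁻¹-↑ˡ; splitAt⁻¹-↑ʳ; any?)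
open import Data.Fin.Subset using (Subset; _∈_; _∉_; _⊆_; _⊂_; _∪_; _─_; _-_; ⁅_⁆; ∣_∣)
open import Data.Fin.Subset.Properties
  using (x∈⁅x⁆; x∈⁅y⁆⇒x≡y; x∈p∪q⁺; x∈p∪q⁻; p⊆p∪q; ⊆-antisym; ∣⁅x⁆∣≡1;
         p─q⊆p; x∈p∧x≢y⇒x∈p-y; x∈p⇒∣p-x∣<∣p∣; _∈?_)
open import Data.Product using (∃-syntax; _×_; _,_; proj₁)
open import Data.Sum using (_⊎_; inj₁; inj₂; [_,_]′)
open import Relation.Nullary using (¬_; yes; no)
open import Relation.Binary.PropositionalEquality
  using (_≡_; _≢_; refl; sym; trans; cong; cong₂; subst; ≢-sym)

x∈p─q⇒x∉q : ∀ {k} {x : Fin k} (p q : Subset k) → x ∈ p ─ q → x ∉ q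
x∈p─q⇒x∉q (true ∷ p) (false ∷ q) here ()
x∈p─q⇒x∉q (_ ∷ p) (_ ∷ q) (there x∈) (there x∈q) = x∈p─q⇒x∉q p q x∈ x∈q

x∈p-y⁻ : ∀ {k} {x y : Fin k} (p : Subset k) → x ∈ p - y → x ∈ p × x ≢ y
x∈p-y⁻ {y = y} p x∈ =
  p─q⊆p p ⁅ y ⁆ x∈ , λ { refl → x∈p─q⇒x∉q p ⁅ y ⁆ x∈ (x∈⁅x⁆ y) }

∣p∪q∣≤∣p∣+∣q∣ : ∀ {k} (p q : Subset k) → ∣ p ∪ q ∣ ≤ ∣ p ∣ + ∣ q ∣
∣p∪q∣≤∣p∣+∣q∣ [] [] = z≤n
∣p∪q∣≤∣p∣+∣q∣ (true ∷ p) (true ∷ q) =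
  s≤s (≤-trans (∣p∪q∣≤∣p∣+∣q∣ p q) (≤-trans (n≤1+n _) (≤-reflexive (sym (+-suc _ _)))))
∣p∪q∣≤∣p∣+∣q∣ (true ∷ p) (false ∷ q) = s≤s (∣p∪q∣≤∣p∣+∣q∣ p q)
∣p∪q∣≤∣p∣+∣q∣ (false ∷ p) (true ∷ q) =
  ≤-trans (s≤s (∣p∪q∣≤∣p∣+∣q∣ p q)) (≤-reflexive (sym (+-suc _ _)))
∣p∪q∣≤∣p∣+∣q∣ (false ∷ p) (false ∷ q) = ∣p∪q∣≤∣p∣+∣q∣ p q

∈-slid⁻ : ∀ {k} {v u w : Fin k} (S : Subset k) → v ∈ (S - u) ∪ ⁅ w ⁆ →
  (v ∈ S × v ≢ u) ⊎ v ≡ w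
∈-slid⁻ {u = u} {w} S v∈ with x∈p∪q⁻ (S - u) ⁅ w ⁆ v∈
... | inj₁ v∈S-u = inj₁ (x∈p-y⁻ S v∈S-u)
... | inj₂ v∈⁅w⁆ = inj₂ (x∈⁅y⁆⇒x≡y w v∈⁅w⁆)

∈-slid⁺ : ∀ {k} {v u w : Fin k} {S : Subset k} → (v ∈ S × v ≢ u) ⊎ v ≡ w →
  v ∈ (S - u) ∪ ⁅ w ⁆
∈-slid⁺ (inj₁ (v∈S , v≢u)) = x∈p∪q⁺ (inj₁ (x∈p∧x≢y⇒x∈p-y v∈S v≢u))
∈-slid⁺ {w = w} (inj₂ refl) = x∈p∪q⁺ (inj₂ (x∈⁅x⁆ w))

one-member : ∀ {k x} {p : Subset k} → x ∈ p → 1 ≤ ∣ p ∣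
one-member x∈p = ≤-trans (s≤s z≤n) (x∈p⇒∣p-x∣<∣p∣ x∈p)

two-members : ∀ {k x y} {p : Subset k} → x ∈ p → y ∈ p → x ≢ y → 2 ≤ ∣ p ∣
two-members x∈p y∈p x≢y =
  ≤-trans (s≤s (one-member (x∈p∧x≢y⇒x∈p-y y∈p (≢-sym x≢y)))) (x∈p⇒∣p-x∣<∣p∣ x∈p)

three-members : ∀ {k x y z} {p : Subset k} → x ∈ p → y ∈ p → z ∈ p →
  x ≢ y → x ≢ z → y ≢ z → 3 ≤ ∣ p ∣
three-members x∈p y∈p z∈p x≢y x≢z y≢z =
  ≤-trans (s≤s (two-members (x∈p∧x≢y⇒x∈p-y y∈p (≢-sym x≢y))
                            (x∈p∧x≢y⇒x∈p-y z∈p (≢-sym x≢z)) y≢z))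
          (x∈p⇒∣p-x∣<∣p∣ x∈p)

no-three-members : ∀ {k x y z} {p : Subset k} → ∣ p ∣ ≤ 2 → x ∈ p → y ∈ p → z ∈ p →
  x ≢ y → x ≢ z → y ≢ z → ⊥
no-three-members ∣p∣≤2 x∈p y∈p z∈p x≢y x≢z y≢z
  with ≤-trans (three-members x∈p y∈p z∈p x≢y x≢z y≢z) ∣p∣≤2
... | s≤s (s≤s ())

module GraphFacts (G : Graph) where

  V : Set
  V = Fin (n G)

  edge-sym : ∀ {u v : V} → Edge G u v → Edge G v u
  edge-sym {u} {v} = subst T (Graph.sym G u v)

  no-loop : ∀ {v : V} → ¬ Edge G v v
  no-loop {v} = subst T (irref G v)

  -- If S is total dominating, a vertex x ∉ S added to S has no private
  -- neighbour (every vertex already sees S - {x} = S), so no proper superset of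
  -- S is irredundant.
  no-irredundant-superset : ∀ {S T} → TotalDominating G S → S ⊂ T → ¬ Irredundant G T
  no-irredundant-superset tdS (S⊆T , x , x∈T , x∉S) irrT with irrT x x∈T
  ... | p , _ , p-excl with tdS p
  ... | w , w∈S , p~w =
    p-excl w (S⊆T w∈S) (λ { refl → x∉S w∈S }) (inj₂ p~w)

  total-irredundant⇒maximal : ∀ {S} → Irredundant G S → TotalDominating G S →
    MaxIrredundant G S
  total-irredundant⇒maximal irrS tdS = irrS , λ T S⊂T → no-irredundant-superset tdS S⊂T

  Undominated : VSet G → V → Set
  Undominated T u = ∀ w → w ∈ T → ¬ InClosedNbhd G u w

  PrivatesAvoid : VSet G → V → Set
  PrivatesAvoid T u = ∀ v → v ∈ T → ∃[ p ] (IsPrivate G T v p × ¬ InClosedNbhd G p u)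

  -- Extension criterion: under these two conditions T ∪ {u} is irredundant,
  -- u being its own private neighbour.
  extend-irredundant : ∀ {T} u → Undominated T u → PrivatesAvoid T u →
    Irredundant G (T ∪ ⁅ u ⁆)
  extend-irredundant {T} u undom avoid v v∈ with x∈p∪q⁻ T ⁅ u ⁆ v∈
  ... | inj₂ v∈⁅u⁆ with x∈⁅y⁆⇒x≡y u v∈⁅u⁆
  ...   | refl = v , inj₁ refl , excl
    where
    excl : ∀ w → w ∈ T ∪ ⁅ v ⁆ → w ≢ v → ¬ InClosedNbhd G v w
    excl w w∈ w≢v with x∈p∪q⁻ T ⁅ v ⁆ w∈
    ... | inj₁ w∈T = undom w w∈T
    ... | inj₂ w∈⁅v⁆ = ⊥-elim (w≢v (x∈⁅y⁆⇒x≡y v w∈⁅v⁆))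
  extend-irredundant {T} u undom avoid v v∈ | inj₁ v∈T with avoid v v∈T
  ... | p , (p∈N[v] , p-excl) , p∉N[u] = p , p∈N[v] , excl
    where
    excl : ∀ w → w ∈ T ∪ ⁅ u ⁆ → w ≢ v → ¬ InClosedNbhd G p w
    excl w w∈ w≢v with x∈p∪q⁻ T ⁅ u ⁆ w∈
    ... | inj₁ w∈T = p-excl w w∈T w≢v
    ... | inj₂ w∈⁅u⁆ with x∈⁅y⁆⇒x≡y u w∈⁅u⁆
    ...   | refl = p∉N[u]

  not-maximal : ∀ {T} u → Undominated T u → PrivatesAvoid T u → ¬ MaxIrredundant G T
  not-maximal {T} u undom avoid (_ , maximal) =
    maximal (T ∪ ⁅ u ⁆) (p⊆p∪q ⁅ u ⁆ , u , x∈p∪q⁺ (inj₂ (x∈⁅x⁆ u)) , u∉T)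
            (extend-irredundant u undom avoid)
    where
    u∉T : u ∉ T
    u∉T u∈T = undom u u∈T (inj₁ refl)

  nbhd-sym : ∀ {p x : V} → InClosedNbhd G p x → InClosedNbhd G x p
  nbhd-sym (inj₁ refl) = inj₁ refl
  nbhd-sym (inj₂ p~x) = inj₂ (edge-sym p~x)

  dominator : ∀ {T} → Dominating G T → ∀ v → ∃[ w ] (w ∈ T × InClosedNbhd G v w)
  dominator dom v with dom v
  ... | inj₁ v∈T = v , v∈T , inj₁ refl
  ... | inj₂ (w , w∈T , v~w) = w , w∈T , inj₂ v~w

  walk-last : ∀ {T u v} → WalkIn G T u v → u ≡ v ⊎ ∃[ w ] (w ∈ T × Edge G w v)
  walk-last (here _) = inj₁ refl
  walk-last (there {u} u∈T u~w rest) with walk-last rest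
  ... | inj₁ refl = inj₂ (u , u∈T , u~w)
  ... | inj₂ last = inj₂ last

  another-member : ∀ {T : VSet G} {x y} → x ∈ T → y ∈ T → x ≢ y →
    ∀ v → ∃[ w ] (w ∈ T × w ≢ v)
  another-member {x = x} x∈T y∈T x≢y v with x ≟ v
  ... | yes refl = _ , y∈T , ≢-sym x≢y
  ... | no x≢v = x , x∈T , x≢v

  -- A connected dominating set with two distinct vertices is total dominating:
  -- a vertex v ∈ T is entered, in G[T], by a walk from another vertex of T.
  connected-dominating⇒total : ∀ {T x y} → ConnectedDominating G T →
    x ∈ T → y ∈ T → x ≢ y → TotalDominating G T
  connected-dominating⇒total {T} (dom , conn) x∈T y∈T x≢y v with dom v
  ... | inj₂ nbr = nbr
  ... | inj₁ v∈T with another-member x∈T y∈T x≢y v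
  ...   | w , w∈T , w≢v with walk-last (conn w v w∈T v∈T)
  ...     | inj₁ w≡v = ⊥-elim (w≢v w≡v)
  ...     | inj₂ (u , u∈T , u~v) = u , u∈T , edge-sym u~v

  module TwoSet (x y : V) (x≢y : x ≢ y) where

    set : VSet G
    set = ⁅ x ⁆ ∪ ⁅ y ⁆

    x∈set : x ∈ set
    x∈set = x∈p∪q⁺ (inj₁ (x∈⁅x⁆ x))

    y∈set : y ∈ set
    y∈set = x∈p∪q⁺ (inj₂ (x∈⁅x⁆ y))

    members : ∀ {w} → w ∈ set → w ≡ x ⊎ w ≡ y
    members w∈ with x∈p∪q⁻ ⁅ x ⁆ ⁅ y ⁆ w∈
    ... | inj₁ w∈⁅x⁆ = inj₁ (x∈⁅y⁆⇒x≡y x w∈⁅x⁆)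
    ... | inj₂ w∈⁅y⁆ = inj₂ (x∈⁅y⁆⇒x≡y y w∈⁅y⁆)

    size≤2 : ∣ set ∣ ≤ 2
    size≤2 = ≤-trans (∣p∪q∣≤∣p∣+∣q∣ ⁅ x ⁆ ⁅ y ⁆)
                     (≤-reflexive (cong₂ _+_ (∣⁅x⁆∣≡1 x) (∣⁅x⁆∣≡1 y)))

    pinned : ∀ {T} → x ∈ T → y ∈ T → ∣ T ∣ ≤ 2 → T ≡ set
    pinned {T} x∈T y∈T ∣T∣≤2 = ⊆-antisym T⊆set set⊆T
      where
      T⊆set : T ⊆ set
      T⊆set {w} w∈T with w ≟ x | w ≟ y
      ... | yes refl | _ = x∈set
      ... | no _ | yes refl = y∈set
      ... | no w≢x | no w≢y =
        ⊥-elim (no-three-members ∣T∣≤2 x∈T y∈T w∈T x≢y (≢-sym w≢x) (≢-sym w≢y))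
      set⊆T : set ⊆ T
      set⊆T w∈ with members w∈
      ... | inj₁ refl = x∈T
      ... | inj₂ refl = y∈T

    partner : V → V
    partner v with v ≟ x
    ... | yes _ = y
    ... | no _ = x

    partner-x : partner x ≡ y
    partner-x with x ≟ x
    ... | yes _ = refl
    ... | no x≢x = ⊥-elim (x≢x refl)

    partner-y : partner y ≡ x
    partner-y with y ≟ x
    ... | yes y≡x = ⊥-elim (x≢y (sym y≡x))
    ... | no _ = refl

    matching : Edge G x y → HasPerfectMatching G set
    matching x~y = partner , match
      where
      match : ∀ v → v ∈ set → partner v ∈ set × Edge G v (partner v) × partner (partner v) ≡ v
      match v v∈ with members v∈
      ... | inj₁ refl rewrite partner-x | partner-y = y∈set , x~y , refl
      ... | inj₂ refl rewrite partner-y | partner-x = x∈set , edge-sym x~y , refl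

    connected : Edge G x y → InducedConnected G set
    connected x~y u v u∈ v∈ with members u∈ | members v∈
    ... | inj₁ refl | inj₁ refl = here x∈set
    ... | inj₁ refl | inj₂ refl = there x∈set x~y (here y∈set)
    ... | inj₂ refl | inj₁ refl = there y∈set (edge-sym x~y) (here x∈set)
    ... | inj₂ refl | inj₂ refl = here y∈set

    irredundant : ∀ {p q} → InClosedNbhd G p x → ¬ InClosedNbhd G p y →
      InClosedNbhd G q y → ¬ InClosedNbhd G q x → Irredundant G set
    irredundant {p} {q} p∈N[x] p∉N[y] q∈N[y] q∉N[x] v v∈ with members v∈
    ... | inj₁ refl = p , p∈N[x] , λ w w∈ w≢x → excl-y (members w∈) w≢x
      where
      excl-y : ∀ {w} → w ≡ x ⊎ w ≡ y → w ≢ x → ¬ InClosedNbhd G p w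
      excl-y (inj₁ w≡x) w≢x = ⊥-elim (w≢x w≡x)
      excl-y (inj₂ refl) _ = p∉N[y]
    ... | inj₂ refl = q , q∈N[y] , λ w w∈ w≢y → excl-x (members w∈) w≢y
      where
      excl-x : ∀ {w} → w ≡ x ⊎ w ≡ y → w ≢ y → ¬ InClosedNbhd G q w
      excl-x (inj₁ refl) _ = q∉N[x]
      excl-x (inj₂ w≡y) w≢y = ⊥-elim (w≢y w≡y)

module PairRealisation (G H : Graph) (c : Fin (n G)) (e : Fin (n H) → Fin (n G))
    (c≢e : ∀ a → c ≢ e a)
    (e-injective : ∀ {a b} → e a ≡ e b → a ≡ b)
    (e-preserves : ∀ {a b} → Edge H a b → Edge G (e a) (e b))
    (e-reflects : ∀ {a b} → Edge G (e a) (e b) → Edge H a b) where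

  open GraphFacts G

  module Pair (a : Fin (n H)) = TwoSet c (e a) (c≢e a)

  pair : Fin (n H) → VSet G
  pair a = Pair.set a

  Anchored : VSet G → Set
  Anchored T = c ∈ T × ∃[ a ] e a ∈ T

  pair-injective : ∀ {a b} → pair a ≡ pair b → a ≡ b
  pair-injective {a} {b} eq with Pair.members b (subst (e a ∈_) eq (Pair.y∈set a))
  ... | inj₁ ea≡c = ⊥-elim (c≢e a (sym ea≡c))
  ... | inj₂ ea≡eb = e-injective ea≡eb

  edge⇒slide : ∀ {a b} → Edge H a b → SlideAdj G (pair a) (pair b)
  edge⇒slide {a} {b} a~b =
    e a , e b , Pair.y∈set a , Pair.y∈set b , e-preserves a~b , ⊆-antisym ⊆slid slid⊆
    where
    ⊆slid : pair b ⊆ (pair a - e a) ∪ ⁅ e b ⁆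
    ⊆slid v∈ with Pair.members b v∈
    ... | inj₁ refl = ∈-slid⁺ (inj₁ (Pair.x∈set a , c≢e a))
    ... | inj₂ refl = ∈-slid⁺ (inj₂ refl)
    slid⊆ : (pair a - e a) ∪ ⁅ e b ⁆ ⊆ pair b
    slid⊆ v∈ with ∈-slid⁻ (pair a) v∈
    ... | inj₂ refl = Pair.y∈set b
    ... | inj₁ (v∈pair , v≢ea) with Pair.members a v∈pair
    ...   | inj₁ refl = Pair.x∈set b
    ...   | inj₂ v≡ea = ⊥-elim (v≢ea v≡ea)

  -- Conversely a slide between pairs must move e a to e b: it cannot remove
  -- or add c, since both pairs contain c exactly once.
  slide⇒edge : ∀ {a b} → SlideAdj G (pair a) (pair b) → Edge H a b
  slide⇒edge {a} {b} (u , w , u∈ , w∈ , u~w , eq) with Pair.members a u∈ | Pair.members b w∈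
  ... | inj₁ refl | inj₁ refl = ⊥-elim (no-loop u~w)
  ... | inj₁ refl | inj₂ refl
        with ∈-slid⁻ (pair a) (subst (c ∈_) eq (Pair.x∈set b))
  ...     | inj₁ (_ , c≢c) = ⊥-elim (c≢c refl)
  ...     | inj₂ c≡eb = ⊥-elim (c≢e b c≡eb)
  slide⇒edge {a} {b} (u , w , u∈ , w∈ , u~w , eq) | inj₂ refl | inj₁ refl
        with ∈-slid⁻ (pair a) (subst (e b ∈_) eq (Pair.y∈set b))
  ...     | inj₂ eb≡c = ⊥-elim (c≢e b (sym eb≡c))
  ...     | inj₁ (eb∈pair , eb≢ea) with Pair.members a eb∈pair
  ...       | inj₁ eb≡c = ⊥-elim (c≢e b (sym eb≡c))
  ...       | inj₂ eb≡ea = ⊥-elim (eb≢ea eb≡ea)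
  slide⇒edge {a} {b} (u , w , u∈ , w∈ , u~w , eq) | inj₂ refl | inj₂ refl = e-reflects u~w

  module _ (π : Param) (pairs-qualify : ∀ a → SetType π G (pair a))
           (small-anchored : ∀ T → SetType π G T → ∣ T ∣ ≤ 2 → Anchored T) where

    at-least-two : ∀ T → SetType π G T → 2 ≤ ∣ T ∣
    at-least-two T qualifies with ≤-total 2 ∣ T ∣
    ... | inj₁ 2≤∣T∣ = 2≤∣T∣
    ... | inj₂ ∣T∣≤2 with small-anchored T qualifies ∣T∣≤2
    ...   | c∈T , a , ea∈T = two-members c∈T ea∈T (c≢e a)

    pair-minimum : ∀ a → IsPiSet π G (pair a)
    pair-minimum a =
      pairs-qualify a , λ T qualifies → ≤-trans (Pair.size≤2 a) (at-least-two T qualifies)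

    minimum-small : Fin (n H) → ∀ T → IsPiSet π G T → ∣ T ∣ ≤ 2
    minimum-small a₀ T (_ , minimal) =
      ≤-trans (minimal (pair a₀) (pairs-qualify a₀)) (Pair.size≤2 a₀)

    minimum-is-pair : Fin (n H) → ∀ T → IsPiSet π G T → ∃[ b ] pair b ≡ T
    minimum-is-pair a₀ T minT@(qualifies , _)
      with small-anchored T qualifies (minimum-small a₀ T minT)
    ... | c∈T , b , eb∈T = b , sym (Pair.pinned b c∈T eb∈T (minimum-small a₀ T minT))

    realisation : Fin (n H) → PiGraphIso π G H
    realisation a₀ =
      pair , pair-minimum , (λ a b → pair-injective) , minimum-is-pair a₀ ,
      λ a b → edge⇒slide , slide⇒edge

module Construction (H : Graph) (m : ℕ) where

  h : ℕ
  h = n H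

  -- Vertices are classified by kind; adjacency depends only on the kinds.
  data Kind : Set where
    centre leaf : Kind
    apex : Fin 2 → Kind
    copy : Fin h → Kind

  adjKind : Kind → Kind → Bool
  adjKind (copy a) (copy b) = adj H a b
  adjKind centre (copy _) = true
  adjKind (copy _) centre = true
  adjKind centre leaf = true
  adjKind leaf centre = true
  adjKind (apex _) (copy _) = true
  adjKind (copy _) (apex _) = true
  adjKind _ _ = false

  adjKind-sym : ∀ k k' → adjKind k k' ≡ adjKind k' k
  adjKind-sym centre centre = refl
  adjKind-sym centre leaf = refl
  adjKind-sym centre (apex _) = refl
  adjKind-sym centre (copy _) = refl
  adjKind-sym leaf centre = refl
  adjKind-sym leaf leaf = refl
  adjKind-sym leaf (apex _) = refl
  adjKind-sym leaf (copy _) = refl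
  adjKind-sym (apex _) centre = refl
  adjKind-sym (apex _) leaf = refl
  adjKind-sym (apex _) (apex _) = refl
  adjKind-sym (apex _) (copy _) = refl
  adjKind-sym (copy _) centre = refl
  adjKind-sym (copy _) leaf = refl
  adjKind-sym (copy _) (apex _) = refl
  adjKind-sym (copy a) (copy b) = Graph.sym H a b

  adjKind-irrefl : ∀ k → adjKind k k ≡ false
  adjKind-irrefl centre = refl
  adjKind-irrefl leaf = refl
  adjKind-irrefl (apex _) = refl
  adjKind-irrefl (copy a) = irref H a

  -- The vertices after the copy of H: c, z₀, z₁, then the m + 3 leaves.
  M : ℕ
  M = 3 + (3 + m)

  tailKind : Fin M → Kind
  tailKind zero = centre
  tailKind (suc zero) = apex zero
  tailKind (suc (suc zero)) = apex (suc zero)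
  tailKind (suc (suc (suc _))) = leaf

  kind : Fin (h + M) → Kind
  kind v = [ copy , tailKind ]′ (splitAt h v)

  G : Graph
  G = record
    { n = h + M
    ; adj = λ u v → adjKind (kind u) (kind v)
    ; sym = λ u v → adjKind-sym (kind u) (kind v)
    ; irref = λ v → adjKind-irrefl (kind v)
    }

  open GraphFacts G

  c : V
  c = h ↑ʳ zero

  z : Fin 2 → V
  z zero = h ↑ʳ suc zero
  z (suc zero) = h ↑ʳ suc (suc zero)

  ℓ : Fin (3 + m) → V
  ℓ j = h ↑ʳ suc (suc (suc j))

  e : Fin h → V
  e a = a ↑ˡ M

  kind-tail : ∀ j → kind (h ↑ʳ j) ≡ tailKind j
  kind-tail j rewrite splitAt-↑ʳ h M j = refl

  kind-c : kind c ≡ centre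
  kind-c = kind-tail zero

  kind-z : ∀ i → kind (z i) ≡ apex i
  kind-z zero = kind-tail (suc zero)
  kind-z (suc zero) = kind-tail (suc (suc zero))

  kind-ℓ : ∀ j → kind (ℓ j) ≡ leaf
  kind-ℓ j = kind-tail (suc (suc (suc j)))

  kind-e : ∀ a → kind (e a) ≡ copy a
  kind-e a rewrite splitAt-↑ˡ h a M = refl

  data Unique : Kind → Set where
    centre! : Unique centre
    apex! : ∀ i → Unique (apex i)
    copy! : ∀ a → Unique (copy a)

  vertex : ∀ {k} → Unique k → V
  vertex centre! = c
  vertex (apex! i) = z i
  vertex (copy! a) = e a

  unique : ∀ {w k} (u : Unique k) → kind w ≡ k → w ≡ vertex u
  unique {w} u kw with splitAt h w in split
  ... | inj₁ a = trans (sym (splitAt⁻¹-↑ˡ split)) (copy-vertex kw u)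
    where
    copy-vertex : ∀ {k} → copy a ≡ k → (u : Unique k) → e a ≡ vertex u
    copy-vertex refl (copy! _) = refl
  ... | inj₂ j = trans (sym (splitAt⁻¹-↑ʳ split)) (tail-vertex j kw u)
    where
    tail-vertex : ∀ j {k} → tailKind j ≡ k → (u : Unique k) → h ↑ʳ j ≡ vertex u
    tail-vertex zero refl centre! = refl
    tail-vertex (suc zero) refl (apex! _) = refl
    tail-vertex (suc (suc zero)) refl (apex! _) = refl
    tail-vertex (suc (suc (suc _))) refl ()

  kind-distinct : ∀ {u v k k'} → kind u ≡ k → kind v ≡ k' → k ≢ k' → u ≢ v
  kind-distinct ku kv k≢k' refl = k≢k' (trans (sym ku) kv)

  edge : ∀ {u v k k'} → kind u ≡ k → kind v ≡ k' → T (adjKind k k') → Edge G u v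
  edge refl refl k~k' = k~k'

  kinds-adjacent : ∀ {u v k k'} → kind u ≡ k → kind v ≡ k' → Edge G u v → T (adjKind k k')
  kinds-adjacent refl refl u~v = u~v

  unseen : ∀ {p x k k'} → kind p ≡ k → kind x ≡ k' → k ≢ k' → ¬ T (adjKind k k') →
    ¬ InClosedNbhd G p x
  unseen kp kx k≢k' _ (inj₁ refl) = k≢k' (trans (sym kp) kx)
  unseen kp kx _ k≁k' (inj₂ p~x) = k≁k' (kinds-adjacent kp kx p~x)

  leaf-nbr : ∀ {x w} → kind x ≡ leaf → Edge G x w → w ≡ c
  leaf-nbr {w = w} kx x~w = unique centre! (leaf-adj (kind w) (kinds-adjacent kx refl x~w))
    where
    leaf-adj : ∀ k → T (adjKind leaf k) → k ≡ centre
    leaf-adj centre _ = refl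

  leaf-nbhd : ∀ {u p} → kind u ≡ leaf → InClosedNbhd G p u → p ≡ u ⊎ p ≡ c
  leaf-nbhd ku (inj₁ p≡u) = inj₁ p≡u
  leaf-nbhd ku (inj₂ p~u) = inj₂ (leaf-nbr ku (edge-sym p~u))

  apex-nbr : ∀ {x w i} → kind x ≡ apex i → Edge G x w → ∃[ a ] w ≡ e a
  apex-nbr {w = w} kx x~w with apex-adj (kind w) (kinds-adjacent kx refl x~w)
    where
    apex-adj : ∀ {i} k → T (adjKind (apex i) k) → ∃[ a ] k ≡ copy a
    apex-adj (copy a) _ = a , refl
  ... | a , kw = a , unique (copy! a) kw

  c≢e : ∀ a → c ≢ e a
  c≢e a = kind-distinct kind-c (kind-e a) (λ ())

  c~e : ∀ a → Edge G c (e a)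
  c~e a = edge kind-c (kind-e a) tt

  open PairRealisation G H c e c≢e (λ {a} {b} → ↑ˡ-injective M a b)
    (edge (kind-e _) (kind-e _)) (kinds-adjacent (kind-e _) (kind-e _)) public

  -- c sees the leaves and the copy of H; e a sees c and the apexes.
  pair-total : ∀ a → TotalDominating G (pair a)
  pair-total a x = by-kind (kind x) refl
    where
    by-kind : ∀ k → kind x ≡ k → ∃[ w ] (w ∈ pair a × Edge G x w)
    by-kind centre kx = e a , Pair.y∈set a , edge kx (kind-e a) tt
    by-kind (apex _) kx = e a , Pair.y∈set a , edge kx (kind-e a) tt
    by-kind leaf kx = c , Pair.x∈set a , edge kx kind-c tt
    by-kind (copy _) kx = c , Pair.x∈set a , edge kx kind-c tt

  -- ℓ₀ is private to c and z₀ is private to e a.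
  pair-irredundant : ∀ a → Irredundant G (pair a)
  pair-irredundant a =
    Pair.irredundant a (inj₂ (edge (kind-ℓ zero) kind-c tt))
                       (unseen (kind-ℓ zero) (kind-e a) (λ ()) (λ ()))
                       (inj₂ (edge (kind-z zero) (kind-e a) tt))
                       (unseen (kind-z zero) kind-c (λ ()) (λ ()))

  pair-qualifies : ∀ π a → SetType π G (pair a)
  pair-qualifies ir a = total-irredundant⇒maximal (pair-irredundant a) (pair-total a)
  pair-qualifies γpr a = pair-total a , Pair.matching a (c~e a)
  pair-qualifies γt a = pair-total a
  pair-qualifies γc a = (λ x → inj₂ (pair-total a x)) , Pair.connected a (c~e a)

  -- To dominate ℓ₀ a total dominating set needs c; to dominate z₀, some e a.
  total-anchored : ∀ T → TotalDominating G T → Anchored T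
  total-anchored T td with td (ℓ zero) | td (z zero)
  ... | w , w∈T , ℓ~w | w' , w'∈T , z~w' with apex-nbr (kind-z zero) z~w'
  ...   | a , refl = subst (_∈ T) (leaf-nbr (kind-ℓ zero) ℓ~w) w∈T , a , w'∈T

  -- N[ℓ₀] = {ℓ₀, c} and N[z₀] = {z₀} ∪ e(V(H)) are disjoint.
  leaf-apex-apart : ∀ {x} → InClosedNbhd G (ℓ zero) x → ¬ InClosedNbhd G (z zero) x
  leaf-apex-apart ℓ∈N[x] with leaf-nbhd (kind-ℓ zero) (nbhd-sym ℓ∈N[x])
  ... | inj₁ refl = unseen (kind-z zero) (kind-ℓ zero) (λ ()) (λ ())
  ... | inj₂ refl = unseen (kind-z zero) kind-c (λ ()) (λ ())

  -- A connected dominating set thus has two distinct vertices, so it is total.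
  connected-anchored : ∀ T → ConnectedDominating G T → Anchored T
  connected-anchored T cd with dominator (proj₁ cd) (ℓ zero) | dominator (proj₁ cd) (z zero)
  ... | x , x∈T , ℓ∈N[x] | y , y∈T , z∈N[y] =
    total-anchored T (connected-dominating⇒total cd x∈T y∈T x≢y)
    where
    x≢y : x ≢ y
    x≢y refl = leaf-apex-apart ℓ∈N[x] z∈N[y]

  ℓ-injective : ∀ {i j} → ℓ i ≡ ℓ j → i ≡ j
  ℓ-injective eq = suc-injective (suc-injective (suc-injective (↑ʳ-injective h _ _ eq)))

  missed-leaf : ∀ {T} → ∣ T ∣ ≤ 2 → ∃[ u ] (u ∉ T × kind u ≡ leaf)
  missed-leaf {T} small with ℓ zero ∈? T | ℓ (suc zero) ∈? T | ℓ (suc (suc zero)) ∈? T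
  ... | yes ∈₀ | yes ∈₁ | yes ∈₂ =
    ⊥-elim (no-three-members small ∈₀ ∈₁ ∈₂
             (λ eq → 0≢1+n (ℓ-injective eq)) (λ eq → 0≢1+n (ℓ-injective eq))
             (λ eq → 0≢1+n (suc-injective (ℓ-injective eq))))
  ... | no ∉₀ | _ | _ = ℓ zero , ∉₀ , kind-ℓ zero
  ... | yes _ | no ∉₁ | _ = ℓ (suc zero) , ∉₁ , kind-ℓ (suc zero)
  ... | yes _ | yes _ | no ∉₂ = ℓ (suc (suc zero)) , ∉₂ , kind-ℓ (suc (suc zero))

  missed-apex : ∀ {T x k} → ∣ T ∣ ≤ 2 → x ∈ T → kind x ≡ k → (∀ i → k ≢ apex i) →
    ∃[ i ] z i ∉ T
  missed-apex {T} {x} small x∈T kx not-apex with z zero ∈? T | z (suc zero) ∈? T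
  ... | yes ∈₀ | yes ∈₁ =
    ⊥-elim (no-three-members small x∈T ∈₀ ∈₁ (x≢z zero) (x≢z (suc zero))
             (kind-distinct (kind-z zero) (kind-z (suc zero)) (λ ())))
    where
    x≢z : ∀ i → x ≢ z i
    x≢z i x≡z = not-apex i (trans (sym kx) (trans (cong kind x≡z) (kind-z i)))
  ... | no ∉₀ | _ = zero , ∉₀
  ... | yes _ | no ∉₁ = suc zero , ∉₁

  -- Case c ∉ T, with u a leaf missed by T.  Then u sees only itself and c, so
  -- it is undominated.  A private neighbour p of v ∈ T lies in N[u] = {u, c}
  -- only when p = c; then v is a leaf (its own private neighbour) or some
  -- e a (with a missed apex as private neighbour, since no other e b ∈ T may
  -- see c).
  module MissingCentre (T : VSet G) (irr : Irredundant G T) (small : ∣ T ∣ ≤ 2)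
                       (c∉T : c ∉ T) (u : V) (u∉T : u ∉ T) (ku : kind u ≡ leaf) where

    undominated : Undominated T u
    undominated w w∈T u∈N[w] with leaf-nbhd ku (nbhd-sym u∈N[w])
    ... | inj₁ refl = u∉T w∈T
    ... | inj₂ refl = c∉T w∈T

    centre-private : ∀ {v} → v ∈ T → IsPrivate G T v c →
      ∃[ p ] (IsPrivate G T v p × ¬ InClosedNbhd G p u)
    centre-private {v} v∈T (c∈N[v] , c-excl) = by-kind (kind v) refl
      where
      by-kind : ∀ k → kind v ≡ k → ∃[ p ] (IsPrivate G T v p × ¬ InClosedNbhd G p u)
      by-kind centre kv = ⊥-elim (c∉T (subst (_∈ T) (unique centre! kv) v∈T))
      by-kind (apex _) kv = ⊥-elim (unseen kind-c kv (λ ()) (λ ()) c∈N[v])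
      by-kind leaf kv = v , (inj₁ refl , excl) , λ v∈N[u] → undominated v v∈T (nbhd-sym v∈N[u])
        where
        excl : ∀ w → w ∈ T → w ≢ v → ¬ InClosedNbhd G v w
        excl w w∈T w≢v v∈N[w] with leaf-nbhd kv (nbhd-sym v∈N[w])
        ... | inj₁ w≡v = w≢v w≡v
        ... | inj₂ refl = c∉T w∈T
      by-kind (copy _) kv with missed-apex small v∈T kv (λ i ())
      ... | i , zi∉T =
        z i , (inj₂ (edge (kind-z i) kv tt) , excl) , unseen (kind-z i) ku (λ ()) (λ ())
        where
        excl : ∀ w → w ∈ T → w ≢ v → ¬ InClosedNbhd G (z i) w
        excl w w∈T w≢v (inj₁ refl) = zi∉T w∈T
        excl w w∈T w≢v (inj₂ z~w) with apex-nbr (kind-z i) z~w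
        ... | b , refl = c-excl (e b) w∈T w≢v (inj₂ (c~e b))

    privates-avoid : PrivatesAvoid T u
    privates-avoid v v∈T with irr v v∈T
    ... | p , p-private with p ≟ c
    ...   | yes refl = centre-private v∈T p-private
    ...   | no p≢c = p , p-private , p∉N[u]
      where
      p∉N[u] : ¬ InClosedNbhd G p u
      p∉N[u] p∈N[u] with leaf-nbhd ku p∈N[u]
      ... | inj₁ refl = undominated v v∈T (proj₁ p-private)
      ... | inj₂ p≡c = p≢c p≡c

  -- Case c ∈ T and no e a ∈ T, with z i an apex missed by T.  Then z i sees
  -- only itself and e(V(H)), so it is undominated.  T contains no leaf (c sees
  -- all of N[leaf]), so its members are c, with private neighbour ℓ₀, and
  -- apexes, each its own private neighbour; none of these lies in N[z i].
  module MissingCopies (T : VSet G) (irr : Irredundant G T) (c∈T : c ∈ T)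
                       (no-copy : ∀ a → e a ∉ T) (i : Fin 2) (zi∉T : z i ∉ T) where

    undominated : Undominated T (z i)
    undominated w w∈T (inj₁ refl) = zi∉T w∈T
    undominated w w∈T (inj₂ z~w) with apex-nbr (kind-z i) z~w
    ... | a , refl = no-copy a w∈T

    no-leaf : ∀ {w} → w ∈ T → kind w ≢ leaf
    no-leaf {w} w∈T kw with irr w w∈T
    ... | p , p∈N[w] , p-excl with leaf-nbhd kw p∈N[w]
    ...   | inj₁ refl = p-excl c c∈T (kind-distinct kind-c kw (λ ())) (inj₂ (edge kw kind-c tt))
    ...   | inj₂ refl = p-excl c c∈T (kind-distinct kind-c kw (λ ())) (inj₁ refl)

    privates-avoid : PrivatesAvoid T (z i)
    privates-avoid v v∈T = by-kind (kind v) refl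
      where
      by-kind : ∀ k → kind v ≡ k → ∃[ p ] (IsPrivate G T v p × ¬ InClosedNbhd G p (z i))
      by-kind centre kv with unique centre! kv
      ... | refl = ℓ zero , (inj₂ (edge (kind-ℓ zero) kind-c tt) , excl) ,
                   unseen (kind-ℓ zero) (kind-z i) (λ ()) (λ ())
        where
        excl : ∀ w → w ∈ T → w ≢ c → ¬ InClosedNbhd G (ℓ zero) w
        excl w w∈T w≢c ℓ∈N[w] with leaf-nbhd (kind-ℓ zero) (nbhd-sym ℓ∈N[w])
        ... | inj₁ refl = no-leaf w∈T (kind-ℓ zero)
        ... | inj₂ w≡c = w≢c w≡c
      by-kind (apex _) kv = v , (inj₁ refl , excl) , v∉N[z]
        where
        excl : ∀ w → w ∈ T → w ≢ v → ¬ InClosedNbhd G v w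
        excl w w∈T w≢v (inj₁ v≡w) = w≢v (sym v≡w)
        excl w w∈T w≢v (inj₂ v~w) with apex-nbr kv v~w
        ... | a , refl = no-copy a w∈T
        v∉N[z] : ¬ InClosedNbhd G v (z i)
        v∉N[z] (inj₁ refl) = zi∉T v∈T
        v∉N[z] (inj₂ v~z) = kinds-adjacent kv (kind-z i) v~z
      by-kind leaf kv = ⊥-elim (no-leaf v∈T kv)
      by-kind (copy a) kv = ⊥-elim (no-copy a (subst (_∈ T) (unique (copy! a) kv) v∈T))

  -- A maximal irredundant set of size ≤ 2 is anchored: in both other cases a
  -- vertex missed by T satisfies the extension criterion.
  maxirr-anchored : ∀ T → MaxIrredundant G T → ∣ T ∣ ≤ 2 → Anchored T
  maxirr-anchored T mi small with c ∈? T
  ... | no c∉T with missed-leaf small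
  ...   | u , u∉T , ku = ⊥-elim (not-maximal u undominated privates-avoid mi)
    where open MissingCentre T (proj₁ mi) small c∉T u u∉T ku
  maxirr-anchored T mi small | yes c∈T with any? (λ a → e a ∈? T)
  ...   | yes copy∈T = c∈T , copy∈T
  ...   | no none with missed-apex small c∈T kind-c (λ i ())
  ...     | i , zi∉T = ⊥-elim (not-maximal (z i) undominated privates-avoid mi)
    where open MissingCopies T (proj₁ mi) c∈T (λ a ea∈T → none (a , ea∈T)) i zi∉T

  small-anchored : ∀ π T → SetType π G T → ∣ T ∣ ≤ 2 → Anchored T
  small-anchored ir T mi small = maxirr-anchored T mi small
  small-anchored γpr T (td , _) _ = total-anchored T td
  small-anchored γt T td _ = total-anchored T td
  small-anchored γc T cd _ = connected-anchored T cd

realisable : ∀ π (H : Graph) → 1 ≤ n H → InfinitelyManyRealise π H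
realisable π H 1≤h m =
  G , ≤-trans (m≤n+m m 6) (m≤n+m (6 + m) (n H)) ,
  realisation π (pair-qualifies π) (small-anchored π) (fromℕ< 1≤h)
  where open Construction H m

corollary2 : (H : Graph) → 1 ≤ n H →
    InfinitelyManyRealise ir H × InfinitelyManyRealise γpr H ×
    InfinitelyManyRealise γt H × InfinitelyManyRealise γc H
corollary2 H 1≤h =
  realisable ir H 1≤h , realisable γpr H 1≤h , realisable γt H 1≤h , realisable γc H 1≤h
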